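{- Let $q$ be a non-degenerate quadratic form of dimension at least $4$ over a finite field $F$ and let $a\in\mathsf D(q)$. Then $\mathrm{diam}(\mathcal{G}_{q,a})=2$.
   Context: A quadratic form on a finite-dimensional $F$-vector space $V$ is a map $q:V\to F$ with $q(\lambda x)=\lambda^2q(x)$ such that $b_q(x,y)=q(x+y)-q(x)-q(y)$ is bilinear; non-degenerate means $\{x: b_q(x,y)=0\ \forall y\}=\{0\}$. $\mathsf D(q)=\{q(v):v\in V\}\cap F^\ast$. The representation graph $\mathcal{G}_{q,a}$ has vertex set $V$, with distinct $x,y$ adjacent iff $q(x-y)=a$; the diameter is the supremum of shortest-path distances. -}

module Defs where

open import Level using (Level; _⊔_)
open import Algebra.Bundles using (CommutativeRing)
open import Data.Nat using (ℕ; zero; suc; _≤_; _<_)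
open import Data.Fin using (Fin)
open import Data.Product using (Σ; ∃; _×_; _,_)
open import Relation.Nullary using (¬_)
open import Relation.Binary.Definitions using (Decidable)

data Walk {a r e : Level} {A : Set a} (_≈_ : A → A → Set e) (E : A → A → Set r)
          : A → A → ℕ → Set (a ⊔ r ⊔ e) where
  here : ∀ {x y} → x ≈ y → Walk _≈_ E x y zero
  step : ∀ {x y z k} → E x y → Walk _≈_ E y z k → Walk _≈_ E x z (suc k)

Dist≤ : {a r e : Level} {A : Set a} (_≈_ : A → A → Set e) (E : A → A → Set r)
        → A → A → ℕ → Set (a ⊔ r ⊔ e)
Dist≤ _≈_ E x y k = ∃ λ m → m ≤ k × Walk _≈_ E x y m

DistEq : {a r e : Level} {A : Set a} (_≈_ : A → A → Set e) (E : A → A → Set r)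
         → A → A → ℕ → Set (a ⊔ r ⊔ e)
DistEq _≈_ E x y d = Dist≤ _≈_ E x y d × (∀ k → k < d → ¬ Dist≤ _≈_ E x y k)

HasDiameter : {a r e : Level} {A : Set a} (_≈_ : A → A → Set e) (E : A → A → Set r)
              → ℕ → Set (a ⊔ r ⊔ e)
HasDiameter _≈_ E d =
  (∀ x y → Dist≤ _≈_ E x y d) × (∃ λ x → ∃ λ y → DistEq _≈_ E x y d)

module _ {c ℓ : Level} (R : CommutativeRing c ℓ) where
  open CommutativeRing R

  IsField : Set (c ⊔ ℓ)
  IsField = (¬ (1# ≈ 0#))
          × (∀ x → ¬ (x ≈ 0#) → ∃ λ y → (x * y) ≈ 1#)
          × Decidable _≈_

  IsFinite : Set (c ⊔ ℓ)
  IsFinite = ∃ λ m → Σ (Fin m → Carrier) λ enum → ∀ x → ∃ λ i → enum i ≈ x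

  Vec : ℕ → Set c
  Vec n = Fin n → Carrier

  _≈v_ : ∀ {n} → Vec n → Vec n → Set ℓ
  u ≈v v = ∀ i → u i ≈ v i

  _+v_ : ∀ {n} → Vec n → Vec n → Vec n
  (u +v v) i = u i + v i

  _-v_ : ∀ {n} → Vec n → Vec n → Vec n
  (u -v v) i = u i - v i

  _·v_ : ∀ {n} → Carrier → Vec n → Vec n
  (λ' ·v v) i = λ' * v i

  0v : ∀ {n} → Vec n
  0v i = 0#

  polar : ∀ {n} → (Vec n → Carrier) → Vec n → Vec n → Carrier
  polar q x y = q (x +v y) - q x - q y

  IsQuadraticForm : ∀ {n} → (Vec n → Carrier) → Set (c ⊔ ℓ)
  IsQuadraticForm {n} q =
      (∀ x y → x ≈v y → q x ≈ q y)
    × (∀ (λ' : Carrier) x → q (λ' ·v x) ≈ (λ' * λ') * q x)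
    × (∀ x y z → polar q (x +v y) z ≈ polar q x z + polar q y z)
    × (∀ (λ' : Carrier) x y → polar q (λ' ·v x) y ≈ λ' * polar q x y)
    × (∀ x y z → polar q x (y +v z) ≈ polar q x y + polar q x z)
    × (∀ (λ' : Carrier) x y → polar q x (λ' ·v y) ≈ λ' * polar q x y)

  NonDegenerate : ∀ {n} → (Vec n → Carrier) → Set (c ⊔ ℓ)
  NonDegenerate {n} q = ∀ x → (∀ y → polar q x y ≈ 0#) → x ≈v 0v

  InD : ∀ {n} → (Vec n → Carrier) → Carrier → Set (c ⊔ ℓ)
  InD q a = (¬ (a ≈ 0#)) × (∃ λ v → q v ≈ a)

  RepAdj : ∀ {n} → (Vec n → Carrier) → Carrier → Vec n → Vec n → Set ℓ
  RepAdj q a x y = (¬ (x ≈v y)) × (q (x -v y) ≈ a)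

{-# OPTIONS --safe #-}
module Submission where

-- Two vertices x, z are joined by the path x, z + u, z as soon as q u = a and q (w − u) = a
-- for w = x − z, i.e. q u = a and b(w, u) = q w. For w ≠ 0 pick y with b(w, y) = 1; then
-- p = q(w)·y has b(w, p) = q w, and p is corrected by vectors orthogonal to w and y (a space
-- of dimension ≥ n − 2 ≥ 2) until q takes the value a. If that space contains a nonzero
-- isotropic k, q is affine and non-constant along a suitable line in direction k; otherwise it
-- contains orthogonal k₁, k₂ with q k₁, q k₂ ≠ 0, and over a finite field α s² + β t² takes
-- every value γ, because {α s²} and {γ − β t²} both have more than |F|/2 elements.
-- Conversely, by polarization q is not constantly a on e₀, e₁, e₂ and their sums, and a
-- nonzero vector of value ≠ a is at distance 2 from 0.

open import Defs
open import Level using (Level; _⊔_)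
open import Algebra.Bundles using (CommutativeRing)
open import Data.Nat as ℕ using (ℕ; zero; suc; _≤_; _<_; z≤n; s≤s)
import Data.Nat.Properties as ℕ
open import Data.Fin using (Fin; zero; suc; punchIn; punchOut; #_)
import Data.Fin.Properties as Fin
open import Data.Product using (∃; ∃₂; _×_; _,_; proj₁; proj₂)
open import Data.Sum using (_⊎_; inj₁; inj₂; [_,_])
open import Data.Empty using (⊥-elim)
open import Function using (_∘_; id)
open import Relation.Nullary using (¬_; Dec; yes; no; contradiction)
open import Relation.Binary using (DecSetoid; Rel)
import Relation.Binary.Definitions as B
open import Relation.Binary.PropositionalEquality as ≡ using (_≡_)

-- Algebra.Solver.Ring needs a coefficient ring whose equality computes; ℤ maps into any
-- commutative ring.
module IntegerCoefficientRingSolver {c ℓ} (R : CommutativeRing c ℓ) where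
  open CommutativeRing R hiding (zero)
  open import Data.Integer as ℤ using (ℤ; +_; -[1+_]; _⊖_)
  import Data.Integer.Properties as ℤ
  import Data.Sign as Sign
  open import Data.Maybe using (Maybe; just; nothing)
  open import Algebra.Properties.Ring ring using (-‿distribˡ-*; -‿distribʳ-*)
  open import Algebra.Properties.AbelianGroup +-abelianGroup using (⁻¹-∙-comm)
  open import Algebra.Properties.Group +-group using (ε⁻¹≈ε; ⁻¹-involutive)
  open import Algebra.Properties.CommutativeSemigroup +-commutativeSemigroup using (interchange)
  open import Algebra.Properties.Monoid.Mult +-monoid using (×-homo-+) renaming (_×_ to _×ₙ_)
  open import Algebra.Properties.Semiring.Mult semiring using (×1-homo-*)
  open import Algebra.Solver.Ring.AlmostCommutativeRing
    using (fromCommutativeRing; _-Raw-AlmostCommutative⟶_)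
  open import Relation.Binary.Reasoning.Setoid setoid

  ⟦_⟧ℤ : ℤ → Carrier
  ⟦ + n ⟧ℤ      = n ×ₙ 1#
  ⟦ -[1+ n ] ⟧ℤ = - (suc n ×ₙ 1#)

  ⊖-homo : ∀ m n → ⟦ m ⊖ n ⟧ℤ ≈ m ×ₙ 1# - n ×ₙ 1#
  ⊖-homo m zero rewrite ℤ.⊖-≥ {m} {zero} ℕ.z≤n = sym (trans (+-congˡ ε⁻¹≈ε) (+-identityʳ _))
  ⊖-homo zero (suc n) = sym (+-identityˡ _)
  ⊖-homo (suc m) (suc n) rewrite ℤ.[1+m]⊖[1+n]≡m⊖n m n = begin
    ⟦ m ⊖ n ⟧ℤ                                 ≈⟨ ⊖-homo m n ⟩
    m ×ₙ 1# - n ×ₙ 1#                         ≈⟨ +-identityˡ _ ⟨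
    0# + (m ×ₙ 1# - n ×ₙ 1#)                  ≈⟨ +-congʳ (-‿inverseʳ 1#) ⟨
    (1# - 1#) + (m ×ₙ 1# - n ×ₙ 1#)           ≈⟨ interchange _ _ _ _ ⟩
    (1# + m ×ₙ 1#) + (- 1# - n ×ₙ 1#)         ≈⟨ +-congˡ (⁻¹-∙-comm 1# _) ⟩
    (1# + m ×ₙ 1#) - (1# + n ×ₙ 1#)           ∎

  +-homo : ∀ i j → ⟦ i ℤ.+ j ⟧ℤ ≈ ⟦ i ⟧ℤ + ⟦ j ⟧ℤ
  +-homo (+ m)    (+ n)    = ×-homo-+ 1# m n
  +-homo (+ m)    -[1+ n ] = ⊖-homo m (suc n)
  +-homo -[1+ m ] (+ n)    = trans (⊖-homo n (suc m)) (+-comm _ _)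
  +-homo -[1+ m ] -[1+ n ] = begin
    - (suc (suc (m ℕ.+ n)) ×ₙ 1#)   ≡⟨ ≡.cong (λ k → - (k ×ₙ 1#)) (ℕ.+-suc (suc m) n) ⟨
    - ((suc m ℕ.+ suc n) ×ₙ 1#)     ≈⟨ -‿cong (×-homo-+ 1# (suc m) (suc n)) ⟩
    - (suc m ×ₙ 1# + suc n ×ₙ 1#)   ≈⟨ ⁻¹-∙-comm _ _ ⟨
    - (suc m ×ₙ 1#) - (suc n ×ₙ 1#) ∎

  +◃-homo : ∀ n → ⟦ Sign.+ ℤ.◃ n ⟧ℤ ≈ n ×ₙ 1#
  +◃-homo zero    = refl
  +◃-homo (suc n) = refl

  -◃-homo : ∀ n → ⟦ Sign.- ℤ.◃ n ⟧ℤ ≈ - (n ×ₙ 1#)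
  -◃-homo zero    = sym ε⁻¹≈ε
  -◃-homo (suc n) = refl

  *-homo : ∀ i j → ⟦ i ℤ.* j ⟧ℤ ≈ ⟦ i ⟧ℤ * ⟦ j ⟧ℤ
  *-homo (+ m)    (+ n)    = trans (+◃-homo (m ℕ.* n)) (×1-homo-* m n)
  *-homo (+ m)    -[1+ n ] =
    trans (-◃-homo (m ℕ.* suc n)) (trans (-‿cong (×1-homo-* m (suc n))) (-‿distribʳ-* _ _))
  *-homo -[1+ m ] (+ n)    =
    trans (-◃-homo (suc m ℕ.* n)) (trans (-‿cong (×1-homo-* (suc m) n)) (-‿distribˡ-* _ _))
  *-homo -[1+ m ] -[1+ n ] = begin
    ⟦ Sign.+ ℤ.◃ (suc m ℕ.* suc n) ⟧ℤ         ≈⟨ +◃-homo (suc m ℕ.* suc n) ⟩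
    (suc m ℕ.* suc n) ×ₙ 1#               ≈⟨ ×1-homo-* (suc m) (suc n) ⟩
    (suc m ×ₙ 1#) * (suc n ×ₙ 1#)         ≈⟨ ⁻¹-involutive _ ⟨
    - - ((suc m ×ₙ 1#) * (suc n ×ₙ 1#))   ≈⟨ -‿cong (-‿distribˡ-* _ _) ⟩
    - (- (suc m ×ₙ 1#) * (suc n ×ₙ 1#))   ≈⟨ -‿distribʳ-* _ _ ⟩
    - (suc m ×ₙ 1#) * - (suc n ×ₙ 1#)     ∎

  -‿homo : ∀ i → ⟦ ℤ.- i ⟧ℤ ≈ - ⟦ i ⟧ℤ
  -‿homo (+ zero)  = sym ε⁻¹≈ε
  -‿homo (+ suc n) = refl
  -‿homo -[1+ n ]  = sym (⁻¹-involutive _)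

  homomorphism : ℤ.+-*-rawRing -Raw-AlmostCommutative⟶ fromCommutativeRing R
  homomorphism = record
    { ⟦_⟧ = ⟦_⟧ℤ ; +-homo = +-homo ; *-homo = *-homo ; -‿homo = -‿homo
    ; 0-homo = refl ; 1-homo = +-identityʳ 1# }

  coefficient-≟ : ∀ i j → Maybe (⟦ i ⟧ℤ ≈ ⟦ j ⟧ℤ)
  coefficient-≟ i j with i ℤ.≟ j
  ... | yes ≡.refl = just refl
  ... | no _       = nothing

  open import Algebra.Solver.Ring ℤ.+-*-rawRing (fromCommutativeRing R) homomorphism coefficient-≟ public

module Counting where
  open import Data.Nat using (_+_; _*_)
  open import Data.List using (List; []; _∷_; length; map)
  open import Data.Nat.ListAction using (sum)
  open import Data.List.Relation.Unary.All as All using (All; []; _∷_)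
  open import Data.List.Relation.Unary.Any using (Any; here; there)
  open import Data.List.Relation.Unary.AllPairs using ([]; _∷_)
  open import Relation.Unary using (Pred; Decidable)
  open import Algebra.Properties.CommutativeSemigroup ℕ.+-commutativeSemigroup using (interchange)

  indicator : ∀ {p} {P : Set p} → Dec P → ℕ
  indicator (yes _) = 1
  indicator (no _)  = 0

  count : ∀ {a p} {A : Set a} {P : Pred A p} → Decidable P → List A → ℕ
  count P? []       = 0
  count P? (x ∷ xs) = indicator (P? x) + count P? xs

  count-none : ∀ {a p} {A : Set a} {P : Pred A p} (P? : Decidable P) {xs} →
               All (¬_ ∘ P) xs → count P? xs ≡ 0
  count-none P? []                      = ≡.refl
  count-none P? {x ∷ _} (¬Px ∷ ¬Pxs) with P? x
  ... | yes Px = contradiction Px ¬Px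
  ... | no  _  = count-none P? ¬Pxs

  sum-map-+ : ∀ {a} {A : Set a} (f g : A → ℕ) xs →
              sum (map (λ x → f x + g x) xs) ≡ sum (map f xs) + sum (map g xs)
  sum-map-+ f g []       = ≡.refl
  sum-map-+ f g (x ∷ xs) = ≡.trans (≡.cong (f x + g x +_) (sum-map-+ f g xs))
                                   (interchange (f x) (g x) _ _)

  sum-map-≤ : ∀ {a} {A : Set a} {f : A → ℕ} {k} → (∀ x → f x ≤ k) → ∀ xs →
              sum (map f xs) ≤ k * length xs
  sum-map-≤ {k = k} f≤k []       = ℕ.≤-reflexive (≡.sym (ℕ.*-zeroʳ k))
  sum-map-≤ {k = k} f≤k (x ∷ xs) = ℕ.≤-trans (ℕ.+-mono-≤ (f≤k x) (sum-map-≤ f≤k xs))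
                                             (ℕ.≤-reflexive (≡.sym (ℕ.*-suc k (length xs))))

  sum-map-< : ∀ {a} {A : Set a} {f : A → ℕ} {k} → (∀ x → f x ≤ suc k) → ∀ {xs} →
              Any (λ x → f x ≤ k) xs → sum (map f xs) < suc k * length xs
  sum-map-< {k = k} f≤1+k {x ∷ xs} (here fx≤k) =
    ℕ.≤-trans (ℕ.+-mono-≤ (s≤s fx≤k) (sum-map-≤ f≤1+k xs))
              (ℕ.≤-reflexive (≡.sym (ℕ.*-suc (suc k) (length xs))))
  sum-map-< {f = f} {k} f≤1+k {x ∷ xs} (there fxs≤k) =
    ℕ.≤-trans (ℕ.≤-reflexive (≡.sym (ℕ.+-suc (f x) _)))
      (ℕ.≤-trans (ℕ.+-mono-≤ (f≤1+k x) (sum-map-< f≤1+k fxs≤k))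
                 (ℕ.≤-reflexive (≡.sym (ℕ.*-suc (suc k) (length xs)))))

  module Fibres {a ℓ} (S : DecSetoid a ℓ) where
    open DecSetoid S renaming (Carrier to A)
    open import Data.List.Membership.Setoid setoid using (_∈_)
    open import Data.List.Relation.Unary.Unique.Setoid setoid using (Unique)

    module _ {p} {P : Pred A p} (P? : Decidable P) where

      count-≤1 : ∀ {xs r} → Unique xs → All (λ x → P x → x ≈ r) xs → count P? xs ≤ 1
      count-≤1 [] [] = z≤n
      count-≤1 {x ∷ xs} (x≉xs ∷ xs!) (P⇒≈r ∷ Pxs⇒≈r) with P? x
      ... | no  _  = count-≤1 xs! Pxs⇒≈r
      ... | yes Px = s≤s (ℕ.≤-reflexive (count-none P? (All.zipWith
                      (λ (x≉y , Py⇒≈r) Py → x≉y (trans (P⇒≈r Px) (sym (Py⇒≈r Py))))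
                      (x≉xs , Pxs⇒≈r))))

      count-≤2 : ∀ {xs r r′} → Unique xs → All (λ x → P x → x ≈ r ⊎ x ≈ r′) xs →
                 count P? xs ≤ 2
      count-≤2 [] [] = z≤n
      count-≤2 {x ∷ xs} (x≉xs ∷ xs!) (P⇒± ∷ Pxs⇒±) with P? x
      ... | no  _  = count-≤2 xs! Pxs⇒±
      ... | yes Px with P⇒± Px
      ...   | inj₁ x≈r  = s≤s (count-≤1 xs! (All.zipWith
                            (λ (x≉y , Py⇒±) Py →
                               [ ⊥-elim ∘ x≉y ∘ trans x≈r ∘ sym , id ] (Py⇒± Py))
                            (x≉xs , Pxs⇒±)))
      ...   | inj₂ x≈r′ = s≤s (count-≤1 xs! (All.zipWith
                            (λ (x≉y , Py⇒±) Py →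
                               [ id , ⊥-elim ∘ x≉y ∘ trans x≈r′ ∘ sym ] (Py⇒± Py))
                            (x≉xs , Pxs⇒±)))

    ∈⇒1≤sum-indicator : ∀ {z ys} → z ∈ ys → 1 ≤ sum (map (λ y → indicator (z ≟ y)) ys)
    ∈⇒1≤sum-indicator {z} {y ∷ ys} (here z≈y) with z ≟ y
    ... | yes _   = s≤s z≤n
    ... | no  z≉y = contradiction z≈y z≉y
    ∈⇒1≤sum-indicator {z} {y ∷ ys} (there z∈ys) =
      ℕ.≤-trans (∈⇒1≤sum-indicator z∈ys) (ℕ.m≤n+m _ (indicator (z ≟ y)))

    length≤sum-of-fibres : ∀ {b} {X : Set b} (g : X → A) xs {ys} → (∀ x → g x ∈ ys) →
                           length xs ≤ sum (map (λ y → count (λ x → g x ≟ y) xs) ys)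
    length≤sum-of-fibres g []       g∈ys = z≤n
    length≤sum-of-fibres g (x ∷ xs) {ys} g∈ys = ℕ.≤-trans
      (ℕ.+-mono-≤ (∈⇒1≤sum-indicator (g∈ys x)) (length≤sum-of-fibres g xs g∈ys))
      (ℕ.≤-reflexive (≡.sym (sum-map-+ (λ y → indicator (g x ≟ y))
                                       (λ y → count (λ x → g x ≟ y) xs) ys)))

module FieldProperties {c ℓ} (F : CommutativeRing c ℓ) (isField : IsField F) where
  open CommutativeRing F hiding (zero)
  open import Algebra.Properties.Group +-group using (x∙y⁻¹≈ε⇒x≈y; inverseˡ-unique)
  open import Relation.Binary.Reasoning.Setoid setoid
  open IntegerCoefficientRingSolver F using (solve; _:=_; _:+_; _:*_; _:-_)

  1≉0 : 1# ≉ 0#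
  1≉0 = proj₁ isField

  infix 4 _≟_
  _≟_ : B.Decidable _≈_
  _≟_ = proj₂ (proj₂ isField)

  decSetoid : DecSetoid c ℓ
  decSetoid = record { isDecEquivalence = record { isEquivalence = isEquivalence ; _≟_ = _≟_ } }

  x≈0⇒y*x≈0 : ∀ {x} y → x ≈ 0# → y * x ≈ 0#
  x≈0⇒y*x≈0 y x≈0 = trans (*-congˡ x≈0) (zeroʳ y)

  inverse : ∀ {x} → x ≉ 0# → Carrier
  inverse x≉0 = proj₁ (proj₁ (proj₂ isField) _ x≉0)

  *-inverseˡ : ∀ {x} (x≉0 : x ≉ 0#) → inverse x≉0 * x ≈ 1#
  *-inverseˡ x≉0 = trans (*-comm _ _) (proj₂ (proj₁ (proj₂ isField) _ x≉0))

  *-cancelˡ : ∀ {x} → x ≉ 0# → ∀ {y z} → x * y ≈ x * z → y ≈ z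
  *-cancelˡ {x} x≉0 {y} {z} xy≈xz = begin
    y                      ≈⟨ *-identityˡ y ⟨
    1# * y                 ≈⟨ *-congʳ (*-inverseˡ x≉0) ⟨
    inverse x≉0 * x * y    ≈⟨ *-assoc _ _ _ ⟩
    inverse x≉0 * (x * y)  ≈⟨ *-congˡ xy≈xz ⟩
    inverse x≉0 * (x * z)  ≈⟨ *-assoc _ _ _ ⟨
    inverse x≉0 * x * z    ≈⟨ *-congʳ (*-inverseˡ x≉0) ⟩
    1# * z                 ≈⟨ *-identityˡ z ⟩
    z                      ∎

  InjectiveUpToSign : (Carrier → Carrier) → Set (c ⊔ ℓ)
  InjectiveUpToSign g = ∀ s r → g s ≈ g r → s ≈ r ⊎ s ≈ - r

  square-injectiveUpToSign : InjectiveUpToSign (λ s → s * s)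
  square-injectiveUpToSign s r s²≈r² with s - r ≟ 0#
  ... | yes s-r≈0 = inj₁ (x∙y⁻¹≈ε⇒x≈y s r s-r≈0)
  ... | no  s-r≉0 = inj₂ (inverseˡ-unique s r (*-cancelˡ s-r≉0 (begin
    (s - r) * (s + r)  ≈⟨ solve 2 (λ s r → (s :- r) :* (s :+ r) := s :* s :- r :* r) refl s r ⟩
    s * s - r * r      ≈⟨ +-congʳ s²≈r² ⟩
    r * r - r * r      ≈⟨ -‿inverseʳ _ ⟩
    0#                 ≈⟨ zeroʳ _ ⟨
    (s - r) * 0#       ∎)))

  injective∘square : ∀ {f : Carrier → Carrier} → (∀ {x y} → f x ≈ f y → x ≈ y) →
                     InjectiveUpToSign (λ s → f (s * s))
  injective∘square f-injective s r = square-injectiveUpToSign s r ∘ f-injective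

module FiniteFieldProperties {c ℓ} (F : CommutativeRing c ℓ) (isField : IsField F)
                             (isFinite : IsFinite F) where
  open CommutativeRing F hiding (zero)
  open FieldProperties F isField
  open Counting
  open Counting.Fibres decSetoid
  open import Data.List using (List; length; map; deduplicate; tabulate)
  open import Data.Nat.ListAction using (sum)
  open import Data.List.Relation.Unary.All as All using ()
  open import Data.List.Relation.Unary.All.Properties using (¬Any⇒All¬)
  open import Data.List.Relation.Unary.Any as Any using (Any; any?; satisfied)
  open import Algebra.Definitions _≈_ using (Congruent₁)
  open import Algebra.Properties.Group +-group using (∙-cancelˡ; ⁻¹-injective)
  open import Algebra.Properties.Ring ring using (-0#≈0#)
  open import Data.List.Membership.Setoid setoid using (_∈_)
  open import Data.List.Membership.Setoid.Properties using (∈-resp-≈; ∈-tabulate⁺)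
  open import Data.List.Relation.Unary.Unique.Setoid setoid using (Unique)
  open import Data.List.Relation.Unary.Unique.DecSetoid.Properties using (deduplicate-!)
  open import Data.List.Relation.Unary.Enumerates.Setoid.Properties using (deduplicate⁺)
  open import Relation.Binary.Reasoning.Setoid setoid
  open IntegerCoefficientRingSolver F using (solve; _:=_; _:+_; _:-_)

  elements : List Carrier
  elements = deduplicate _≟_ (tabulate (proj₁ (proj₂ isFinite)))

  elements-unique : Unique elements
  elements-unique = deduplicate-! decSetoid _

  ∈-elements : ∀ x → x ∈ elements
  ∈-elements = deduplicate⁺ decSetoid λ x →
    let (i , enum-i≈x) = proj₂ (proj₂ isFinite) x in ∈-resp-≈ setoid enum-i≈x (∈-tabulate⁺ setoid i)

  fibre : (Carrier → Carrier) → Carrier → ℕ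
  fibre g y = count (λ s → g s ≟ y) elements

  fibre-empty : ∀ {g y} → ¬ Any (λ s → g s ≈ y) elements → fibre g y ≡ 0
  fibre-empty {g} {y} g∌y = count-none (λ s → g s ≟ y) (¬Any⇒All¬ _ g∌y)

  fibre-≤2 : ∀ {g} → InjectiveUpToSign g → ∀ y → fibre g y ≤ 2
  fibre-≤2 {g} g± y with any? (λ s → g s ≟ y) elements
  ... | no  g∌y = ℕ.≤-trans (ℕ.≤-reflexive (fibre-empty g∌y)) z≤n
  ... | yes g∋y with (r , gr≈y) ← satisfied g∋y =
    count-≤2 (λ s → g s ≟ y) {r = r} {r′ = - r} elements-unique
             (All.tabulate λ {s} _ gs≈y → g± s r (trans gs≈y (sym gr≈y)))

  fibre-≤1 : ∀ {g} → InjectiveUpToSign g → ∀ {y} → g 0# ≈ y → fibre g y ≤ 1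
  fibre-≤1 {g} g± {y} g0≈y = count-≤1 (λ s → g s ≟ y) {r = 0#} elements-unique
    (All.tabulate λ {s} _ gs≈y → [ id , (λ s≈-0 → trans s≈-0 -0#≈0#) ] (g± s 0# (trans gs≈y (sym g0≈y))))

  -- If the images were disjoint, the fibres of g and h over any y would hold at most two
  -- points together, and at most one over y ≈ g 0#: the 2|F| points of F ⊎ F would not fit.
  images-meet : ∀ {g h} → Congruent₁ g → Congruent₁ h →
                InjectiveUpToSign g → InjectiveUpToSign h → ∃₂ λ s t → g s ≈ h t
  images-meet {g} {h} g-cong h-cong g± h± with any? (λ s → any? (λ t → g s ≟ h t) elements) elements
  ... | yes meet = let (s , meetₛ) = satisfied meet ; (t , gs≈ht) = satisfied meetₛ in s , t , gs≈ht
  ... | no  none = ⊥-elim (ℕ.<-irrefl ≡.refl (ℕ.≤-<-trans lower upper))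
    where
    N : ℕ
    N = length elements

    disjoint : ∀ s t → g s ≉ h t
    disjoint s t gs≈ht = none (Any.map (λ s≈s′ → Any.map (λ t≈t′ →
      trans (sym (g-cong s≈s′)) (trans gs≈ht (h-cong t≈t′))) (∈-elements t)) (∈-elements s))

    both : Carrier → ℕ
    both y = fibre g y ℕ.+ fibre h y

    both≤fibre-g : ∀ {s y} → g s ≈ y → both y ≤ fibre g y
    both≤fibre-g {s} {y} gs≈y = ℕ.≤-reflexive (≡.trans
      (≡.cong (fibre g y ℕ.+_) (fibre-empty λ h∋y →
        let (t , ht≈y) = satisfied h∋y in disjoint s t (trans gs≈y (sym ht≈y))))
      (ℕ.+-identityʳ _))

    both-≤2 : ∀ y → both y ≤ 2
    both-≤2 y with any? (λ s → g s ≟ y) elements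
    ... | no  g∌y = ℕ.≤-trans (ℕ.≤-reflexive (≡.cong (ℕ._+ fibre h y) (fibre-empty g∌y))) (fibre-≤2 h± y)
    ... | yes g∋y = ℕ.≤-trans (both≤fibre-g (proj₂ (satisfied g∋y))) (fibre-≤2 g± y)

    both-≤1 : ∀ {y} → g 0# ≈ y → both y ≤ 1
    both-≤1 g0≈y = ℕ.≤-trans (both≤fibre-g g0≈y) (fibre-≤1 g± g0≈y)

    lower : N ℕ.+ N ≤ sum (map both elements)
    lower = ℕ.≤-trans (ℕ.+-mono-≤ (length≤sum-of-fibres g elements (∈-elements ∘ g))
                                  (length≤sum-of-fibres h elements (∈-elements ∘ h)))
                      (ℕ.≤-reflexive (≡.sym (sum-map-+ (fibre g) (fibre h) elements)))

    upper : sum (map both elements) < N ℕ.+ N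
    upper = ℕ.<-≤-trans (sum-map-< both-≤2 (Any.map both-≤1 (∈-elements (g 0#))))
                        (ℕ.≤-reflexive (≡.cong (N ℕ.+_) (ℕ.+-identityʳ N)))

  diagonal-binary-form-surjective : ∀ {α β} → α ≉ 0# → β ≉ 0# →
                                    ∀ γ → ∃₂ λ s t → α * (s * s) + β * (t * t) ≈ γ
  diagonal-binary-form-surjective {α} {β} α≉0 β≉0 γ
    with images-meet (λ s≈s′ → *-congˡ (*-cong s≈s′ s≈s′))
                     (λ t≈t′ → +-congˡ (-‿cong (*-congˡ (*-cong t≈t′ t≈t′))))
                     (injective∘square (*-cancelˡ α≉0))
                     (injective∘square (*-cancelˡ β≉0 ∘ ⁻¹-injective ∘ ∙-cancelˡ γ _ _))
  ... | s , t , αs²≈γ-βt² = s , t , (begin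
    α * (s * s) + β * (t * t)          ≈⟨ +-congʳ αs²≈γ-βt² ⟩
    γ - β * (t * t) + β * (t * t)      ≈⟨ solve 2 (λ γ x → γ :- x :+ x := γ) refl γ (β * (t * t)) ⟩
    γ                                  ∎)

module LinearAlgebra {c ℓ} (F : CommutativeRing c ℓ) (isField : IsField F) where
  open CommutativeRing F hiding (zero)
  open FieldProperties F isField
  open import Data.Vec.Functional using (_∷_; head; tail)
  open import Relation.Binary.Reasoning.Setoid setoid
  open IntegerCoefficientRingSolver F using (solve; _:=_; _:+_; _:*_; :-_)

  infix  4 _≈ᵛ_
  infixl 6 _+ᵛ_ _-ᵛ_
  infixr 7 _·ᵛ_

  _≈ᵛ_ : ∀ {n} → Rel (Vec F n) ℓ
  _≈ᵛ_ = _≈v_ F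

  _+ᵛ_ _-ᵛ_ : ∀ {n} → Vec F n → Vec F n → Vec F n
  _+ᵛ_ = _+v_ F
  _-ᵛ_ = _-v_ F

  _·ᵛ_ : ∀ {n} → Carrier → Vec F n → Vec F n
  _·ᵛ_ = _·v_ F

  0ᵛ : ∀ {n} → Vec F n
  0ᵛ = 0v F

  record IsLinear {n} (f : Vec F n → Carrier) : Set (c ⊔ ℓ) where
    field
      cong   : ∀ {x y} → x ≈ᵛ y → f x ≈ f y
      +-homo : ∀ x y → f (x +ᵛ y) ≈ f x + f y
      ·-homo : ∀ λ′ x → f (λ′ ·ᵛ x) ≈ λ′ * f x

  e : ∀ {n} → Fin n → Vec F n
  e zero    = 1# ∷ 0ᵛ
  e (suc i) = 0# ∷ e i

  e≉0 : ∀ {n} (i : Fin n) → ¬ (e i ≈ᵛ 0ᵛ)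
  e≉0 zero    e≈0 = 1≉0 (e≈0 zero)
  e≉0 (suc i) e≈0 = e≉0 i (e≈0 ∘ suc)

  0-linear : ∀ {n} → IsLinear {n} (λ _ → 0#)
  0-linear = record
    { cong   = λ _ → refl
    ; +-homo = λ _ _ → sym (+-identityʳ 0#)
    ; ·-homo = λ λ′ _ → sym (zeroʳ λ′) }

  scaled-linear : ∀ {n} {f : Vec F n → Carrier} (κ : Carrier) → IsLinear f → IsLinear (λ x → κ * f x)
  scaled-linear κ f-linear = record
    { cong   = *-congˡ ∘ cong
    ; +-homo = λ x y → trans (*-congˡ (+-homo x y)) (distribˡ κ _ _)
    ; ·-homo = λ λ′ x → trans (*-congˡ (·-homo λ′ x))
                         (solve 3 (λ κ λ′ y → κ :* (λ′ :* y) := λ′ :* (κ :* y)) refl κ λ′ _) }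
    where open IsLinear f-linear

  ∷-linear : ∀ {n} {f : Vec F (suc n) → Carrier} {t : Vec F n → Carrier} →
             IsLinear f → IsLinear t → IsLinear (λ z → f (t z ∷ z))
  ∷-linear {t = t} f-linear t-linear = record
    { cong   = λ x≈y → Lf.cong λ { zero → Lt.cong x≈y ; (suc j) → x≈y j }
    ; +-homo = λ x y → trans (Lf.cong λ { zero → Lt.+-homo x y ; (suc j) → refl }) (Lf.+-homo _ _)
    ; ·-homo = λ λ′ x →
        trans (Lf.cong λ { zero → Lt.·-homo λ′ x ; (suc j) → refl }) (Lf.·-homo _ _) }
    where
    module Lf = IsLinear f-linear
    module Lt = IsLinear t-linear

  linear-0 : ∀ {n} {f : Vec F n → Carrier} → IsLinear f → f 0ᵛ ≈ 0#
  linear-0 {f = f} f-linear = begin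
    f 0ᵛ             ≈⟨ cong (λ _ → sym (zeroˡ 0#)) ⟩
    f (0# ·ᵛ 0ᵛ)     ≈⟨ ·-homo 0# 0ᵛ ⟩
    0# * f 0ᵛ        ≈⟨ zeroˡ _ ⟩
    0#               ∎
    where open IsLinear f-linear

  linear-∷ : ∀ {n} {f : Vec F (suc n) → Carrier} → IsLinear f →
             ∀ κ z → f (κ ∷ z) ≈ κ * f (e zero) + f (0# ∷ z)
  linear-∷ {f = f} f-linear κ z = begin
    f (κ ∷ z)                         ≈⟨ cong (λ
      { zero    → sym (trans (+-identityʳ _) (*-identityʳ κ))
      ; (suc j) → sym (trans (+-congʳ (zeroʳ κ)) (+-identityˡ _)) }) ⟩
    f (κ ·ᵛ e zero +ᵛ (0# ∷ z))       ≈⟨ +-homo _ _ ⟩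
    f (κ ·ᵛ e zero) + f (0# ∷ z)      ≈⟨ +-congʳ (·-homo κ (e zero)) ⟩
    κ * f (e zero) + f (0# ∷ z)       ∎
    where open IsLinear f-linear

  vanishes-on-basis : ∀ {n} {f : Vec F n → Carrier} → IsLinear f →
                      (∀ i → f (e i) ≈ 0#) → ∀ x → f x ≈ 0#
  vanishes-on-basis {zero} f-linear _ x =
    trans (IsLinear.cong f-linear (λ ())) (linear-0 f-linear)
  vanishes-on-basis {suc n} {f} f-linear f-e≈0 x = begin
    f x                                    ≈⟨ IsLinear.cong f-linear (λ { zero → refl ; (suc j) → refl }) ⟩
    f (head x ∷ tail x)                    ≈⟨ linear-∷ f-linear (head x) (tail x) ⟩
    head x * f (e zero) + f (0# ∷ tail x)  ≈⟨ +-cong (*-congˡ (f-e≈0 zero)) (vanishes-on-basis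
                                                 (∷-linear f-linear 0-linear) (f-e≈0 ∘ suc) (tail x)) ⟩
    head x * 0# + 0#                       ≈⟨ trans (+-identityʳ _) (zeroʳ _) ⟩
    0#                                     ∎

  module KernelParametrisation {n} {f : Vec F (suc n) → Carrier} (f-linear : IsLinear f)
                               (d≉0 : f (e zero) ≉ 0#) where
    d⁻¹ : Carrier
    d⁻¹ = inverse d≉0

    lift : Vec F n → Vec F (suc n)
    lift z = - d⁻¹ * f (0# ∷ z) ∷ z

    lift-linear : ∀ {g} → IsLinear g → IsLinear (g ∘ lift)
    lift-linear g-linear = ∷-linear g-linear (scaled-linear (- d⁻¹) (∷-linear f-linear 0-linear))

    f∘lift≈0 : ∀ z → f (lift z) ≈ 0#
    f∘lift≈0 z = begin
      f (lift z)                        ≈⟨ linear-∷ f-linear _ z ⟩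
      (- d⁻¹ * f₀) * f (e zero) + f₀    ≈⟨ solve 3 (λ u d y → (:- u :* y) :* d :+ y := :- (y :* (u :* d)) :+ y)
                                                 refl d⁻¹ (f (e zero)) f₀ ⟩
      - (f₀ * (d⁻¹ * f (e zero))) + f₀  ≈⟨ +-congʳ (-‿cong (*-congˡ (*-inverseˡ d≉0))) ⟩
      - (f₀ * 1#) + f₀                  ≈⟨ trans (+-congʳ (-‿cong (*-identityʳ f₀))) (-‿inverseˡ f₀) ⟩
      0#                                ∎
      where
      f₀ : Carrier
      f₀ = f (0# ∷ z)

  common-zero : ∀ {m n} → m < n → (fs : Fin m → Vec F n → Carrier) → (∀ i → IsLinear (fs i)) →
                ∃ λ x → ¬ (x ≈ᵛ 0ᵛ) × (∀ i → fs i x ≈ 0#)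
  common-zero {zero} {suc n} _ fs _ = e zero , e≉0 zero , λ ()
  common-zero {suc m} {suc n} (s≤s m<n) fs fs-linear with Fin.all? (λ i → fs i (e zero) ≟ 0#)
  ... | yes fs-e≈0 = e zero , e≉0 zero , fs-e≈0
  ... | no  ¬fs-e≈0 with (i , d≉0) ← Fin.¬∀⟶∃¬ _ _ (λ i → fs i (e zero) ≟ 0#) ¬fs-e≈0 =
    lift-solution (common-zero m<n (λ k → fs (punchIn i k) ∘ lift) (λ k → lift-linear (fs-linear _)))
    where
    open KernelParametrisation (fs-linear i) d≉0

    lift-solution : (∃ λ z → ¬ (z ≈ᵛ 0ᵛ) × (∀ k → fs (punchIn i k) (lift z) ≈ 0#)) →
                    ∃ λ x → ¬ (x ≈ᵛ 0ᵛ) × (∀ j → fs j x ≈ 0#)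
    lift-solution (z , z≉0 , fs-lift-z≈0) = lift z , z≉0 ∘ (_∘ suc) , vanish
      where
      vanish : ∀ j → fs j (lift z) ≈ 0#
      vanish j with j Fin.≟ i
      ... | yes ≡.refl = f∘lift≈0 z
      ... | no  j≢i    = ≡.subst (λ j′ → fs j′ (lift z) ≈ 0#)
                           (Fin.punchIn-punchOut (j≢i ∘ ≡.sym)) (fs-lift-z≈0 (punchOut (j≢i ∘ ≡.sym)))

module QuadraticSpace {c ℓ} (F : CommutativeRing c ℓ) (isField : IsField F) {n : ℕ}
                      (q : Vec F n → CommutativeRing.Carrier F) (isQ : IsQuadraticForm F q) where
  open CommutativeRing F hiding (zero)
  open FieldProperties F isField
  open LinearAlgebra F isField
  open import Data.Vec.Functional using (Vector; _∷_; [])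
  open import Algebra.Properties.Ring ring using (-1*x≈-x; -0#≈0#; x+x≈x⇒x≈0)
  open import Algebra.Properties.Group +-group using (⁻¹-involutive)
  open import Relation.Binary.Reasoning.Setoid setoid
  open IntegerCoefficientRingSolver F using (solve; _:=_; _:+_; _:*_; _:-_; :-_)

  b : Vec F n → Vec F n → Carrier
  b = polar F q

  q-cong : ∀ {x y} → x ≈ᵛ y → q x ≈ q y
  q-cong = proj₁ isQ _ _

  q-homo : ∀ μ x → q (μ ·ᵛ x) ≈ (μ * μ) * q x
  q-homo = proj₁ (proj₂ isQ)

  b-·ˡ : ∀ μ x z → b (μ ·ᵛ x) z ≈ μ * b x z
  b-·ˡ = proj₁ (proj₂ (proj₂ (proj₂ isQ)))

  b-combˡ : ∀ x μ y z → b (x +ᵛ μ ·ᵛ y) z ≈ b x z + μ * b y z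
  b-combˡ x μ y z = trans (proj₁ (proj₂ (proj₂ isQ)) x _ z) (+-congˡ (b-·ˡ μ y z))

  b-linear : ∀ x → IsLinear (b x)
  b-linear x = record
    { cong   = λ y≈y′ →
        +-cong (+-congʳ (q-cong (λ i → +-congˡ (y≈y′ i)))) (-‿cong (q-cong y≈y′))
    ; +-homo = proj₁ (proj₂ (proj₂ (proj₂ (proj₂ isQ)))) x
    ; ·-homo = λ μ y → proj₂ (proj₂ (proj₂ (proj₂ (proj₂ isQ)))) μ x y }

  b-combʳ : ∀ x y μ z → b x (y +ᵛ μ ·ᵛ z) ≈ b x y + μ * b x z
  b-combʳ x y μ z = trans (+-homo y _) (+-congˡ (·-homo μ z))
    where open IsLinear (b-linear x)

  b-sym : ∀ x y → b x y ≈ b y x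
  b-sym x y = begin
    q (x +ᵛ y) - q x - q y   ≈⟨ +-congʳ (+-congʳ (q-cong (λ i → +-comm (x i) (y i)))) ⟩
    q (y +ᵛ x) - q x - q y   ≈⟨ solve 3 (λ Q X Y → Q :- X :- Y := Q :- Y :- X)
                                        refl (q (y +ᵛ x)) (q x) (q y) ⟩
    q (y +ᵛ x) - q y - q x   ∎

  q-0 : q 0ᵛ ≈ 0#
  q-0 = begin
    q 0ᵛ                 ≈⟨ q-cong (λ _ → sym (zeroˡ 0#)) ⟩
    q (0# ·ᵛ 0ᵛ)         ≈⟨ q-homo 0# 0ᵛ ⟩
    (0# * 0#) * q 0ᵛ     ≈⟨ trans (*-congʳ (zeroˡ 0#)) (zeroˡ _) ⟩
    0#                   ∎

  q-+ : ∀ x y → q (x +ᵛ y) ≈ q x + q y + b x y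
  q-+ x y = solve 3 (λ Q X Y → Q := X :+ Y :+ (Q :- X :- Y)) refl (q (x +ᵛ y)) (q x) (q y)

  q-orthogonal : ∀ {x y} → b x y ≈ 0# → q (x +ᵛ y) ≈ q x + q y
  q-orthogonal {x} {y} bxy≈0 = trans (q-+ x y) (trans (+-congˡ bxy≈0) (+-identityʳ _))

  q-- : ∀ x y → q (x -ᵛ y) ≈ q x + q y - b x y
  q-- x y = begin
    q (x -ᵛ y)                                 ≈⟨ q-cong (λ i → +-congˡ (sym (-1*x≈-x (y i)))) ⟩
    q (x +ᵛ - 1# ·ᵛ y)                         ≈⟨ q-+ x _ ⟩
    q x + q (- 1# ·ᵛ y) + b x (- 1# ·ᵛ y)      ≈⟨ +-cong (+-congˡ (q-homo _ y))
                                                          (IsLinear.·-homo (b-linear x) _ y) ⟩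
    q x + (- 1# * - 1#) * q y + - 1# * b x y   ≈⟨ +-cong (+-congˡ (trans (*-congʳ -1²≈1) (*-identityˡ _)))
                                                          (-1*x≈-x _) ⟩
    q x + q y - b x y                          ∎
    where
    -1²≈1 : - 1# * - 1# ≈ 1#
    -1²≈1 = trans (-1*x≈-x (- 1#)) (⁻¹-involutive 1#)

  isotropic-line : ∀ {r k} → q k ≈ 0# → b r k ≉ 0# → ∀ γ → ∃ λ μ → q (r +ᵛ μ ·ᵛ k) ≈ γ
  isotropic-line {r} {k} qk≈0 δ≉0 γ = μ , (begin
    q (r +ᵛ μ ·ᵛ k)                      ≈⟨ q-+ r _ ⟩
    q r + q (μ ·ᵛ k) + b r (μ ·ᵛ k)      ≈⟨ +-cong (trans (+-congˡ (trans (q-homo μ k) (x≈0⇒y*x≈0 _ qk≈0)))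
                                                          (+-identityʳ _))
                                                   (IsLinear.·-homo (b-linear r) μ k) ⟩
    q r + μ * δ                          ≈⟨ solve 4 (λ Q γ u δ → Q :+ ((γ :- Q) :* u) :* δ
                                                                := Q :+ (γ :- Q) :* (u :* δ))
                                                  refl (q r) γ (inverse δ≉0) δ ⟩
    q r + (γ - q r) * (inverse δ≉0 * δ)  ≈⟨ +-congˡ (trans (*-congˡ (*-inverseˡ δ≉0))
                                                           (*-identityʳ _)) ⟩
    q r + (γ - q r)                      ≈⟨ solve 2 (λ Q γ → Q :+ (γ :- Q) := γ) refl (q r) γ ⟩
    γ                                    ∎)
    where
    δ : Carrier
    δ = b r k

    μ : Carrier
    μ = (γ - q r) * inverse δ≉0

  polarization-vectors : Vec F n → Vec F n → Vec F n → Vector (Vec F n) 7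
  polarization-vectors x y z = x ∷ y ∷ z ∷ x +ᵛ y ∷ x +ᵛ z ∷ y +ᵛ z ∷ x +ᵛ (y +ᵛ z) ∷ []

  constant-on-polarization-vectors : ∀ {a} x y z → (∀ i → q (polarization-vectors x y z i) ≈ a) → a ≈ 0#
  constant-on-polarization-vectors {a} x y z qv≈a = begin
    a           ≈⟨ ⁻¹-involutive a ⟨
    - - a       ≈⟨ -‿cong (x+x≈x⇒x≈0 (- a) (begin
                     - a + - a       ≈⟨ +-cong (b≈-a (qv≈a (# 3)) (qv≈a (# 0)) (qv≈a (# 1)))
                                               (b≈-a (qv≈a (# 4)) (qv≈a (# 0)) (qv≈a (# 2))) ⟨
                     b x y + b x z   ≈⟨ IsLinear.+-homo (b-linear x) y z ⟨
                     b x (y +ᵛ z)    ≈⟨ b≈-a (qv≈a (# 6)) (qv≈a (# 0)) (qv≈a (# 5)) ⟩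
                     - a             ∎)) ⟩
    - 0#        ≈⟨ -0#≈0# ⟩
    0#          ∎
    where
    b≈-a : ∀ {u v} → q (u +ᵛ v) ≈ a → q u ≈ a → q v ≈ a → b u v ≈ - a
    b≈-a qu+v qu qv = trans (+-cong (+-cong qu+v (-‿cong qu)) (-‿cong qv))
                            (solve 1 (λ a → a :- a :- a := :- a) refl a)

  module Nondegenerate (nd : NonDegenerate F q) where

    nondegenerate-witness : ∀ {w} → ¬ (w ≈ᵛ 0ᵛ) → ∃ λ y → b w y ≈ 1#
    nondegenerate-witness {w} w≉0 with Fin.all? (λ j → b w (e j) ≟ 0#)
    ... | yes w⊥e = contradiction (nd w (vanishes-on-basis (b-linear w) w⊥e)) w≉0
    ... | no  w⊥̸e with (j , bwe≉0) ← Fin.¬∀⟶∃¬ _ _ (λ j → b w (e j) ≟ 0#) w⊥̸e =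
      inverse bwe≉0 ·ᵛ e j , trans (IsLinear.·-homo (b-linear w) _ (e j)) (*-inverseˡ bwe≉0)

    module Decomposition (isFinite : IsFinite F) (a : Carrier) where
      open FiniteFieldProperties F isField isFinite using (diagonal-binary-form-surjective)

      module Direction {w y} (bwy≈1 : b w y ≈ 1#) where
        p : Vec F n
        p = q w ·ᵛ y

        bwp≈qw : b w p ≈ q w
        bwp≈qw = trans (IsLinear.·-homo (b-linear w) _ y) (trans (*-congˡ bwy≈1) (*-identityʳ _))

        Orthogonal : Vec F n → Set ℓ
        Orthogonal k = b w k ≈ 0# × b y k ≈ 0#

        bpk≈0 : ∀ {k} → b y k ≈ 0# → b p k ≈ 0#
        bpk≈0 byk≈0 = trans (b-·ˡ (q w) y _) (x≈0⇒y*x≈0 (q w) byk≈0)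

        isotropic-case : ∀ {k z₀} → Orthogonal k → q k ≈ 0# → b k z₀ ≈ 1# →
                         ∃ λ u → q u ≈ a × b w u ≈ q w
        isotropic-case {k} {z₀} (bwk≈0 , byk≈0) qk≈0 bkz₀≈1 =
          let (μ , qu≈a) = isotropic-line qk≈0 (1≉0 ∘ trans (sym brk≈1)) a
          in r +ᵛ μ ·ᵛ k , qu≈a , bwu≈qw μ
          where
          z : Vec F n
          z = z₀ +ᵛ (- b w z₀) ·ᵛ y

          r : Vec F n
          r = p +ᵛ z

          bwz≈0 : b w z ≈ 0#
          bwz≈0 = begin
            b w z                      ≈⟨ b-combʳ w z₀ _ y ⟩
            b w z₀ + - b w z₀ * b w y  ≈⟨ +-congˡ (trans (*-congˡ bwy≈1) (*-identityʳ _)) ⟩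
            b w z₀ - b w z₀            ≈⟨ -‿inverseʳ _ ⟩
            0#                         ∎

          brk≈1 : b r k ≈ 1#
          brk≈1 = begin
            b r k                             ≈⟨ trans (b-sym r k) (IsLinear.+-homo (b-linear k) p z) ⟩
            b k p + b k z                     ≈⟨ +-cong (trans (b-sym k p) (bpk≈0 byk≈0)) (b-combʳ k z₀ _ y) ⟩
            0# + (b k z₀ + - b w z₀ * b k y)  ≈⟨ +-identityˡ _ ⟩
            b k z₀ + - b w z₀ * b k y         ≈⟨ +-congˡ (x≈0⇒y*x≈0 _ (trans (b-sym k y) byk≈0)) ⟩
            b k z₀ + 0#                       ≈⟨ +-identityʳ _ ⟩
            b k z₀                            ≈⟨ bkz₀≈1 ⟩
            1#                                ∎

          bwu≈qw : ∀ μ → b w (r +ᵛ μ ·ᵛ k) ≈ q w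
          bwu≈qw μ = begin
            b w (r +ᵛ μ ·ᵛ k)           ≈⟨ b-combʳ w r μ k ⟩
            b w r + μ * b w k           ≈⟨ +-cong (IsLinear.+-homo (b-linear w) p z) (*-congˡ bwk≈0) ⟩
            b w p + b w z + μ * 0#      ≈⟨ +-cong (+-cong bwp≈qw bwz≈0) (zeroʳ μ) ⟩
            q w + 0# + 0#               ≈⟨ trans (+-identityʳ _) (+-identityʳ _) ⟩
            q w                         ∎

        anisotropic-case : ∀ {k₁ k₂} → Orthogonal k₁ → Orthogonal k₂ → b k₁ k₂ ≈ 0# →
                           q k₁ ≉ 0# → q k₂ ≉ 0# → ∃ λ u → q u ≈ a × b w u ≈ q w
        anisotropic-case {k₁} {k₂} (bwk₁≈0 , byk₁≈0) (bwk₂≈0 , byk₂≈0) bk₁k₂≈0 qk₁≉0 qk₂≉0 =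
          let (s , t , form≈a-qp) = diagonal-binary-form-surjective qk₁≉0 qk₂≉0 (a - q p)
          in p +ᵛ s ·ᵛ k₁ +ᵛ t ·ᵛ k₂ , qu≈a form≈a-qp , bwu≈qw s t
          where
          qu≈a : ∀ {s t} → q k₁ * (s * s) + q k₂ * (t * t) ≈ a - q p →
                 q (p +ᵛ s ·ᵛ k₁ +ᵛ t ·ᵛ k₂) ≈ a
          qu≈a {s} {t} form≈a-qp = begin
            q (p +ᵛ s ·ᵛ k₁ +ᵛ t ·ᵛ k₂)               ≈⟨ q-orthogonal p+sk₁⊥tk₂ ⟩
            q (p +ᵛ s ·ᵛ k₁) + q (t ·ᵛ k₂)             ≈⟨ +-congʳ (q-orthogonal p⊥sk₁) ⟩
            q p + q (s ·ᵛ k₁) + q (t ·ᵛ k₂)            ≈⟨ +-cong (+-congˡ (q-homo s k₁)) (q-homo t k₂) ⟩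
            q p + (s * s) * q k₁ + (t * t) * q k₂      ≈⟨ solve 5 (λ P S T Q₁ Q₂ → P :+ S :* Q₁ :+ T :* Q₂
                                                                             := P :+ (Q₁ :* S :+ Q₂ :* T))
                                                              refl (q p) (s * s) (t * t) (q k₁) (q k₂) ⟩
            q p + (q k₁ * (s * s) + q k₂ * (t * t))    ≈⟨ +-congˡ form≈a-qp ⟩
            q p + (a - q p)                            ≈⟨ solve 2 (λ P A → P :+ (A :- P) := A) refl (q p) a ⟩
            a                                          ∎
            where
            p⊥sk₁ : b p (s ·ᵛ k₁) ≈ 0#
            p⊥sk₁ = trans (IsLinear.·-homo (b-linear p) s k₁) (x≈0⇒y*x≈0 s (bpk≈0 byk₁≈0))

            p+sk₁⊥tk₂ : b (p +ᵛ s ·ᵛ k₁) (t ·ᵛ k₂) ≈ 0#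
            p+sk₁⊥tk₂ = begin
              b (p +ᵛ s ·ᵛ k₁) (t ·ᵛ k₂)  ≈⟨ IsLinear.·-homo (b-linear _) t k₂ ⟩
              t * b (p +ᵛ s ·ᵛ k₁) k₂     ≈⟨ *-congˡ (b-combˡ p s k₁ k₂) ⟩
              t * (b p k₂ + s * b k₁ k₂)  ≈⟨ x≈0⇒y*x≈0 t (trans (+-cong (bpk≈0 byk₂≈0) (x≈0⇒y*x≈0 s bk₁k₂≈0))
                                                                (+-identityʳ 0#)) ⟩
              0#                          ∎

          bwu≈qw : ∀ s t → b w (p +ᵛ s ·ᵛ k₁ +ᵛ t ·ᵛ k₂) ≈ q w
          bwu≈qw s t = begin
            b w (p +ᵛ s ·ᵛ k₁ +ᵛ t ·ᵛ k₂)    ≈⟨ b-combʳ w _ t k₂ ⟩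
            b w (p +ᵛ s ·ᵛ k₁) + t * b w k₂  ≈⟨ +-cong (b-combʳ w p s k₁) (x≈0⇒y*x≈0 t bwk₂≈0) ⟩
            b w p + s * b w k₁ + 0#          ≈⟨ +-identityʳ _ ⟩
            b w p + s * b w k₁               ≈⟨ +-cong bwp≈qw (x≈0⇒y*x≈0 s bwk₁≈0) ⟩
            q w + 0#                         ≈⟨ +-identityʳ _ ⟩
            q w                              ∎

        solution : 3 < n → ∃ λ u → q u ≈ a × b w u ≈ q w
        solution 3<n
          with (k₁ , k₁≉0 , k₁⊥) ← common-zero (ℕ.<⇒≤ 3<n) (b w ∷ b y ∷ [])
                                     (λ { zero → b-linear w ; (suc zero) → b-linear y })
          with (k₂ , k₂≉0 , k₂⊥) ← common-zero 3<n (b w ∷ b y ∷ b k₁ ∷ [])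
                                     (λ { zero → b-linear w ; (suc zero) → b-linear y
                                        ; (suc (suc zero)) → b-linear k₁ })
          with q k₁ ≟ 0# | q k₂ ≟ 0#
        ... | yes qk₁≈0 | _ =
          isotropic-case (k₁⊥ zero , k₁⊥ (suc zero)) qk₁≈0 (proj₂ (nondegenerate-witness k₁≉0))
        ... | no _ | yes qk₂≈0 =
          isotropic-case (k₂⊥ zero , k₂⊥ (suc zero)) qk₂≈0 (proj₂ (nondegenerate-witness k₂≉0))
        ... | no qk₁≉0 | no qk₂≉0 =
          anisotropic-case (k₁⊥ zero , k₁⊥ (suc zero)) (k₂⊥ zero , k₂⊥ (suc zero)) (k₂⊥ (suc (suc zero)))
                           qk₁≉0 qk₂≉0

      polar-solution : 3 < n → (∃ λ v → q v ≈ a) → ∀ w → ∃ λ u → q u ≈ a × b w u ≈ q w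
      polar-solution 3<n (v , qv≈a) w with Fin.all? (λ i → w i ≟ 0#)
      ... | yes w≈0 = v , qv≈a , (begin
        b w v      ≈⟨ trans (b-sym w v) (IsLinear.cong (b-linear v) w≈0) ⟩
        b v 0ᵛ     ≈⟨ linear-0 (b-linear v) ⟩
        0#         ≈⟨ q-0 ⟨
        q 0ᵛ       ≈⟨ q-cong (λ i → sym (w≈0 i)) ⟩
        q w        ∎)
      ... | no  w≉0 = Direction.solution (proj₂ (nondegenerate-witness w≉0)) 3<n

      sum-of-two : 3 < n → (∃ λ v → q v ≈ a) → ∀ w → ∃ λ u → q u ≈ a × q (w -ᵛ u) ≈ a
      sum-of-two 3<n a∈D w = let (u , qu≈a , bwu≈qw) = polar-solution 3<n a∈D w in u , qu≈a , (begin
        q (w -ᵛ u)        ≈⟨ q-- w u ⟩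
        q w + q u - b w u ≈⟨ +-cong (+-congˡ qu≈a) (-‿cong bwu≈qw) ⟩
        q w + a - q w     ≈⟨ solve 2 (λ W A → W :+ A :- W := A) refl (q w) a ⟩
        a                 ∎)

  module RepresentationGraph {a} (a≉0 : a ≉ 0#) where

    Adjacent : Vec F n → Vec F n → Set ℓ
    Adjacent = RepAdj F q a

    adjacent : ∀ {x z} → q (x -ᵛ z) ≈ a → Adjacent x z
    adjacent {x} {z} qx-z≈a = x≉z , qx-z≈a
      where
      x≉z : ¬ (x ≈ᵛ z)
      x≉z x≈z = a≉0 (begin
        a           ≈⟨ qx-z≈a ⟨
        q (x -ᵛ z)  ≈⟨ q-cong (λ i → trans (+-congʳ (x≈z i)) (-‿inverseʳ (z i))) ⟩
        q 0ᵛ        ≈⟨ q-0 ⟩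
        0#          ∎)

    distance≤2 : (∀ w → ∃ λ u → q u ≈ a × q (w -ᵛ u) ≈ a) → ∀ x z → Dist≤ _≈ᵛ_ Adjacent x z 2
    distance≤2 sum-of-two x z =
      let (u , qu≈a , qw-u≈a) = sum-of-two (x -ᵛ z)
      in 2 , ℕ.≤-refl , step (adjacent (first-leg qw-u≈a)) (step (adjacent (second-leg qu≈a)) (here λ _ → refl))
      where
      first-leg : ∀ {u} → q (x -ᵛ z -ᵛ u) ≈ a → q (x -ᵛ (z +ᵛ u)) ≈ a
      first-leg {u} = trans (q-cong λ i → solve 3 (λ x z u → x :- (z :+ u) := x :- z :- u) refl (x i) (z i) (u i))

      second-leg : ∀ {u} → q u ≈ a → q (z +ᵛ u -ᵛ z) ≈ a
      second-leg {u} = trans (q-cong λ i → solve 2 (λ z u → z :+ u :- z := u) refl (z i) (u i))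

    far-from-0 : ∀ {y} → ¬ (y ≈ᵛ 0ᵛ) → q y ≉ a → ∀ k → k < 2 → ¬ Dist≤ _≈ᵛ_ Adjacent y 0ᵛ k
    far-from-0 y≉0 qy≉a k k<2 (0 , _ , here y≈0) = y≉0 y≈0
    far-from-0 {y} y≉0 qy≉a k k<2 (1 , _ , step {y = z} (_ , qy-z≈a) (here z≈0)) =
      qy≉a (trans (q-cong y≈y-z) qy-z≈a)
      where
      y≈y-z : y ≈ᵛ y -ᵛ z
      y≈y-z i = sym (trans (+-congˡ (trans (-‿cong (z≈0 i)) -0#≈0#)) (+-identityʳ (y i)))
    far-from-0 y≉0 qy≉a k k<2 (suc (suc _) , m≤k , _) with ℕ.≤-trans (s≤s m≤k) k<2
    ... | s≤s (s≤s ())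

    diameter-2 : (∀ w → ∃ λ u → q u ≈ a × q (w -ᵛ u) ≈ a) → (∃ λ y → ¬ (y ≈ᵛ 0ᵛ) × q y ≉ a) →
                 HasDiameter _≈ᵛ_ Adjacent 2
    diameter-2 sum-of-two (y , y≉0 , qy≉a) =
      distance≤2 sum-of-two , y , 0ᵛ , distance≤2 sum-of-two y 0ᵛ , far-from-0 y≉0 qy≉a

module _ {c ℓ} (F : CommutativeRing c ℓ) (isField : IsField F) where
  open CommutativeRing F hiding (zero)
  open FieldProperties F isField
  open LinearAlgebra F isField

  vector-off-value : ∀ {n} → 2 < n → (q : Vec F n → Carrier) → IsQuadraticForm F q →
                     ∀ {a} → a ≉ 0# → ∃ λ y → ¬ (y ≈ᵛ 0ᵛ) × q y ≉ a
  vector-off-value (s≤s (s≤s (s≤s _))) q isQ {a} a≉0 =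
    let (i , qvᵢ≉a) = Fin.¬∀⟶∃¬ 7 _ (λ i → q (vs i) ≟ a)
                                    (a≉0 ∘ constant-on-polarization-vectors e₀ e₁ e₂)
    in vs i , vs≉0 i , qvᵢ≉a
    where
    open QuadraticSpace F isField q isQ

    e₀ e₁ e₂ : Vec F _
    e₀ = e zero
    e₁ = e (suc zero)
    e₂ = e (suc (suc zero))

    vs : Fin 7 → Vec F _
    vs = polarization-vectors e₀ e₁ e₂

    1+0≉0 : 1# + 0# ≉ 0#
    1+0≉0 = 1≉0 ∘ trans (sym (+-identityʳ 1#))

    vs≉0 : ∀ i → ¬ (vs i ≈ᵛ 0ᵛ)
    vs≉0 zero                                             = e≉0 zero
    vs≉0 (suc zero)                                       = e≉0 (suc zero)
    vs≉0 (suc (suc zero))                                 = e≉0 (suc (suc zero))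
    vs≉0 (suc (suc (suc zero))) vᵢ≈0                      = 1+0≉0 (vᵢ≈0 zero)
    vs≉0 (suc (suc (suc (suc zero)))) vᵢ≈0                = 1+0≉0 (vᵢ≈0 zero)
    vs≉0 (suc (suc (suc (suc (suc zero))))) vᵢ≈0          = 1+0≉0 (vᵢ≈0 (suc zero))
    vs≉0 (suc (suc (suc (suc (suc (suc zero)))))) vᵢ≈0    =
      1+0≉0 (trans (+-congˡ (sym (+-identityʳ 0#))) (vᵢ≈0 zero))

lemma3p17 : {c ℓ : Level} (F : CommutativeRing c ℓ) → IsField F → IsFinite F
            → (n : ℕ) → 4 ≤ n
            → (q : Vec F n → CommutativeRing.Carrier F)
            → IsQuadraticForm F q → NonDegenerate F q
            → (a : CommutativeRing.Carrier F) → InD F q a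
            → HasDiameter (_≈v_ F) (RepAdj F q a) 2
lemma3p17 F isField isFinite n 4≤n q isQ nd a (a≉0 , a∈D) =
  diameter-2 (sum-of-two 4≤n a∈D) (vector-off-value F isField (ℕ.<⇒≤ 4≤n) q isQ a≉0)
  where
  open QuadraticSpace.RepresentationGraph F isField q isQ a≉0
  open QuadraticSpace.Nondegenerate.Decomposition F isField q isQ nd isFinite a
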